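{- Let $C\in\{2,6\}$ and let $\Phi$ be a CNF formula on variables $x_1,\dots,x_n$ in which every clause contains between $k$ and $Ck$ distinct variables and every variable appears in at most $d$ clauses. Let $D = Cdk$ and let $s>0$. Suppose that $e D s \leq 2^k$. Let $\mathcal{D}$ be the uniform distribution on satisfying assignments of $\Phi$. Then for every variable $x_i$, $$\frac{1}{2} - \frac{2}{s} \leq \Pr_{\mathcal{D}}[x_i = T] \leq \frac{1}{2} + \frac{2}{s}.$$
   Context: A CNF formula is a conjunction of clauses, each an OR of literals (variables or their negations). $T$ and $F$ denote true and false.
   Formalization: The parameter s ranges over the positive rationals. -}

module Defs where

open import Data.Bool using (Bool; true; false; _∧_; _∨_; not)
open import Data.Nat as ℕ using (ℕ; zero; suc)
open import Data.Nat using (_!)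
open import Data.Fin using (Fin; _≟_)
open import Data.List using (List; []; _∷_; length; filter; map)
open import Data.Bool.ListAction using (any; all)
open import Data.Nat.Properties using (_!≢0)
open import Data.Vec using (Vec; lookup)
import Data.Vec as V
open import Data.Product using (_×_; _,_; proj₁; proj₂; ∃)
open import Data.Integer using (+_)
open import Data.Rational using (ℚ; 0ℚ; _/_; _+_; _*_; _>_; 1/_; >-nonZero)
open import Relation.Nullary using (does)
open import Relation.Unary using (Pred)

-- A literal: a variable together with a polarity
-- (true = positive literal x_i, false = negated literal ¬x_i).
Literal : ℕ → Set
Literal n = Fin n × Bool

Clause : ℕ → Set
Clause n = List (Literal n)

CNF : ℕ → Set
CNF n = List (Clause n)

Assignment : ℕ → Set
Assignment n = Vec Bool n

evalLit : ∀ {n} → Assignment n → Literal n → Bool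
evalLit σ (i , true)  = lookup σ i
evalLit σ (i , false) = not (lookup σ i)

evalClause : ∀ {n} → Assignment n → Clause n → Bool
evalClause σ c = any (evalLit σ) c

evalCNF : ∀ {n} → Assignment n → CNF n → Bool
evalCNF σ Φ = all (evalClause σ) Φ

occurs : ∀ {n} → Fin n → Clause n → Bool
occurs i c = any (λ l → does (i ≟ proj₁ l)) c

numVars : ∀ {n} → Clause n → ℕ
numVars {n} c = length (filter (λ i → occurs i c ≟B true) (Data.List.allFin n))
  where
  open import Data.Bool.Properties renaming (_≟_ to _≟B_)

degree : ∀ {n} → CNF n → Fin n → ℕ
degree Φ i = length (filter (λ c → occurs i c ≟B true) Φ)
  where
  open import Data.Bool.Properties renaming (_≟_ to _≟B_)

allAssignments : (n : ℕ) → List (Assignment n)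
allAssignments zero    = V.[] ∷ []
allAssignments (suc n) =
  map (true V.∷_) (allAssignments n) Data.List.++ map (false V.∷_) (allAssignments n)

satAssignments : ∀ {n} → CNF n → List (Assignment n)
satAssignments {n} Φ = filter (λ σ → evalCNF σ Φ ≟B true) (allAssignments n)
  where
  open import Data.Bool.Properties renaming (_≟_ to _≟B_)

Satisfiable : ∀ {n} → CNF n → Set
Satisfiable {n} Φ = ∃ λ (σ : Assignment n) → evalCNF σ Φ ≡ true
  where
  open import Relation.Binary.PropositionalEquality using (_≡_)

-- Pr_D[x_i = T] where D is the uniform distribution on satisfying
-- assignments of Φ.  (Junk value 0 if Φ is unsatisfiable; the theorem
-- assumes satisfiability, so this value is never used there.)
prTrue : ∀ {n} → CNF n → Fin n → ℚ
prTrue Φ i with length (satAssignments Φ)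
... | zero  = 0ℚ
... | suc m = (+ length (filter (λ σ → lookup σ i ≟B true) (satAssignments Φ))) / suc m
  where
  open import Data.Bool.Properties renaming (_≟_ to _≟B_)

-- Euler's number e, via its partial sums  e_N = Σ_{j<N} 1/j!.
-- "e · x ≤ y" (for x ≥ 0) is expressed as "e_N · x ≤ y for every N",
-- i.e. e = sup_N e_N.

eApprox : ℕ → ℚ
eApprox zero    = 0ℚ
eApprox (suc N) = eApprox N + (+ 1) / (N !)
  where
  instance
    _ = N !≢0

module Submission where

-- All probabilities are counts of
-- assignments among the 2ⁿ, and K = 2^k.  The argument has three steps.
--  1. Conditional local lemma (ConditionalBound.cond-bound): if every clause has at least log₂ K
--     and at most M variables, every variable lies in at most d clauses and 4Md ≤ K, then,
--     conditioned on satisfying S, any event of probability ≤ 1/K reading ≤ M variables has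
--     probability ≤ 2/K.  By strong induction on |S|: the event is independent of the clauses
--     avoiding its variables (`independent`), and dropping the ≤ Md clauses meeting them at most
--     halves the number of solutions (`far-mass`, using the induction hypothesis clause by clause).
--  2. Flipping x_i (flip-bound): a solution with x_i = b remains one after flipping x_i unless the
--     flip violates one of the deg(x_i) clauses containing x_i, each a rare event; hence
--     K·#(x_i = b) ≤ K·#(x_i = ¬b) + deg(x_i)·2·#solutions.
--  3. Arithmetic (Bias.share-bound, Ratio): using 2·deg(x_i) ≤ D and e ≥ e₃ = 5/2, and splitting
--     into s ≤ 4 (the bound is trivial) and s > 4 (then 4D ≤ K and steps 1-2 apply), the share of
--     x_i = T lies within 1/2 ± 2/s; the last step moves this to ℚ by cross-multiplication.

module Proof where

  open import Data.Bool using (Bool; true; false; _∧_; _∨_; not; if_then_else_)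
  import Data.Bool.Properties as BoolP
  open import Data.Bool.Properties using () renaming (_≟_ to _≟ᵇ_)
  open import Data.Bool.ListAction using (any; all)
  open import Data.Nat using (ℕ; zero; suc; _+_; _*_; _^_; _≤_; _<_; z≤n; s≤s; _≤?_; >-nonZero; >-nonZero⁻¹)
  import Data.Nat as ℕ
  import Data.Nat.Properties as ℕP
  open import Data.Nat.Solver using (module +-*-Solver)
  open import Data.Nat.ListAction using (sum)
  open import Data.Nat.Coprimality using (Coprime)
  open import Data.List using (List; []; _∷_; length; _++_; filter; map; allFin; tabulate)
  open import Data.List.Properties using (map-tabulate; length-++)
  open import Data.List.Membership.Propositional using (_∈_)
  open import Data.List.Membership.Propositional.Properties using (∈-allFin)
  open import Data.List.Relation.Unary.Any using (here; there)
  open import Data.List.Relation.Unary.All using (All; []; _∷_)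
  import Data.List.Relation.Unary.All as All
  import Data.List.Relation.Unary.All.Properties as AllP
  open import Data.Vec using (lookup) renaming ([] to []ᵥ; _∷_ to _∷ᵥ_)
  open import Data.Fin using (Fin; zero; suc; _≟_)
  open import Data.Integer as ℤ using (+[1+_])
  import Data.Integer.Properties as ℤP
  open import Data.Rational as ℚ using (ℚ; mkℚ; _/_; 1/_)
  import Data.Rational.Properties as ℚP
  open import Data.Rational.Unnormalised as ℚᵘ using (ℚᵘ; mkℚᵘ; _≃_)
  import Data.Rational.Unnormalised.Properties as ℚᵘP
  open import Data.Product using (Σ; _,_; _×_; proj₁; proj₂)
  open import Data.Sum using (_⊎_; inj₁; inj₂)
  open import Data.Empty using (⊥-elim)
  open import Relation.Nullary using (does; yes; no; ¬_)
  open import Relation.Nullary.Decidable using (dec-true)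
  open import Relation.Binary.PropositionalEquality
  open import Defs

  true≢false : ¬ (true ≡ false)
  true≢false ()

  ∧-weakenʳ : ∀ a {b c} → (b ≡ true → c ≡ true) → a ∧ b ≡ true → a ∧ c ≡ true
  ∧-weakenʳ true b⇒c ab = b⇒c ab

  count : {A : Set} → (A → Bool) → List A → ℕ
  count p []       = 0
  count p (x ∷ xs) = (if p x then 1 else 0) + count p xs

  select : {A : Set} → (A → Bool) → List A → List A
  select p = filter (λ x → p x ≟ᵇ true)

  module _ {A : Set} where

    count-cong : {p q : A → Bool} → (∀ x → p x ≡ q x) → (xs : List A) → count p xs ≡ count q xs
    count-cong p≗q []       = refl
    count-cong p≗q (x ∷ xs) = cong₂ (λ b m → (if b then 1 else 0) + m) (p≗q x) (count-cong p≗q xs)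

    count-mono : {p q : A → Bool} → (∀ x → p x ≡ true → q x ≡ true) → (xs : List A) →
      count p xs ≤ count q xs
    count-mono             p⇒q []       = z≤n
    count-mono {p} {q} p⇒q (x ∷ xs) with p x in px
    ... | false = ℕP.≤-trans (count-mono p⇒q xs) (ℕP.m≤n+m _ _)
    ... | true rewrite p⇒q x px = s≤s (count-mono p⇒q xs)

    count-none : (p : A → Bool) → (∀ x → p x ≡ false) → (xs : List A) → count p xs ≡ 0
    count-none p none []       = refl
    count-none p none (x ∷ xs) rewrite none x = count-none p none xs

    count-++ : (p : A → Bool) (xs ys : List A) → count p (xs ++ ys) ≡ count p xs + count p ys
    count-++ p []       ys = refl
    count-++ p (x ∷ xs) ys = trans (cong (_ +_) (count-++ p xs ys)) (sym (ℕP.+-assoc (if p x then 1 else 0) (count p xs) (count p ys)))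

    count-map : {B : Set} (p : B → Bool) (f : A → B) (xs : List A) →
      count p (map f xs) ≡ count (λ x → p (f x)) xs
    count-map p f []       = refl
    count-map p f (x ∷ xs) = cong (_ +_) (count-map p f xs)

    count-∨ : (p q : A → Bool) (xs : List A) →
      count (λ x → p x ∨ q x) xs ≤ count p xs + count q xs
    count-∨ p q []       = z≤n
    count-∨ p q (x ∷ xs) with p x | q x
    ... | true  | true  = s≤s (ℕP.≤-trans (count-∨ p q xs) (ℕP.+-monoʳ-≤ (count p xs) (ℕP.n≤1+n _)))
    ... | true  | false = s≤s (count-∨ p q xs)
    ... | false | true  = ℕP.≤-trans (s≤s (count-∨ p q xs)) (ℕP.≤-reflexive (sym (ℕP.+-suc _ _)))
    ... | false | false = count-∨ p q xs

    count-split : (g p : A → Bool) (xs : List A) →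
      count p xs ≡ count (λ x → g x ∧ p x) xs + count (λ x → not (g x) ∧ p x) xs
    count-split g p []       = refl
    count-split g p (x ∷ xs) with g x | p x
    ... | true  | true  = cong suc (count-split g p xs)
    ... | true  | false = count-split g p xs
    ... | false | true  = trans (cong suc (count-split g p xs)) (sym (ℕP.+-suc _ _))
    ... | false | false = count-split g p xs

    count-witness : (p : A → Bool) (xs : List A) → 0 < count p xs → Σ A (λ x → x ∈ xs × p x ≡ true)
    count-witness p (x ∷ xs) pos with p x in px
    ... | true  = x , here refl , px
    ... | false with (y , y∈xs , py) ← count-witness p xs pos = y , there y∈xs , py

    count-pos : (p : A → Bool) {x : A} {xs : List A} → x ∈ xs → p x ≡ true → 0 < count p xs
    count-pos p {xs = y ∷ ys} (here refl) py rewrite py = s≤s z≤n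
    count-pos p {xs = y ∷ ys} (there x∈ys) px = ℕP.≤-trans (count-pos p x∈ys px) (ℕP.m≤n+m _ _)

    length≡count : (xs : List A) → length xs ≡ count (λ _ → true) xs
    length≡count []       = refl
    length≡count (x ∷ xs) = cong suc (length≡count xs)

    count-select : (p q : A → Bool) (xs : List A) →
      count q (select p xs) ≡ count (λ x → p x ∧ q x) xs
    count-select p q []       = refl
    count-select p q (x ∷ xs) with p x
    ... | true  = cong (_ +_) (count-select p q xs)
    ... | false = count-select p q xs

    length-select : (p : A → Bool) (xs : List A) → length (select p xs) ≡ count p xs
    length-select p xs = begin
      length (select p xs)              ≡⟨ length≡count (select p xs) ⟩
      count (λ _ → true) (select p xs)  ≡⟨ count-select p (λ _ → true) xs ⟩
      count (λ x → p x ∧ true) xs       ≡⟨ count-cong (λ x → BoolP.∧-identityʳ (p x)) xs ⟩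
      count p xs                        ∎
      where open ≡-Reasoning

    count-partition : (p q : A → Bool) (xs : List A) →
      count q (select p xs) + count q (select (λ x → not (p x)) xs) ≡ count q xs
    count-partition p q xs = begin
      count q (select p xs) + count q (select (λ x → not (p x)) xs)
        ≡⟨ cong₂ _+_ (count-select p q xs) (count-select (λ x → not (p x)) q xs) ⟩
      count (λ x → p x ∧ q x) xs + count (λ x → not (p x) ∧ q x) xs
        ≡⟨ sym (count-split p q xs) ⟩
      count q xs ∎
      where open ≡-Reasoning

    all-partition : (p q : A → Bool) (xs : List A) →
      all q xs ≡ all q (select p xs) ∧ all q (select (λ x → not (p x)) xs)
    all-partition p q []       = refl
    all-partition p q (x ∷ xs) with p x
    ... | true  = trans (cong (q x ∧_) (all-partition p q xs))
                    (sym (BoolP.∧-assoc (q x) (all q (select p xs)) (all q (select (λ x → not (p x)) xs))))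
    ... | false = trans (cong (q x ∧_) (all-partition p q xs))
                    (∧-swap (q x) (all q (select p xs)) (all q (select (λ x → not (p x)) xs)))
      where
      ∧-swap : ∀ a b c → a ∧ (b ∧ c) ≡ b ∧ (a ∧ c)
      ∧-swap true  b c = refl
      ∧-swap false b c = sym (BoolP.∧-zeroʳ b)

    all-++ : (q : A → Bool) (xs ys : List A) → all q (xs ++ ys) ≡ all q xs ∧ all q ys
    all-++ q []       ys = refl
    all-++ q (x ∷ xs) ys = trans (cong (q x ∧_) (all-++ q xs ys)) (sym (BoolP.∧-assoc (q x) (all q xs) (all q ys)))

    count-any : {B : Set} (R : B → A → Bool) (ys : List B) (xs : List A) →
      count (λ x → any (λ y → R y x) ys) xs ≤ sum (map (λ y → count (R y) xs) ys)
    count-any R []       xs = ℕP.≤-reflexive (count-none _ (λ _ → refl) xs)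
    count-any R (y ∷ ys) xs = ℕP.≤-trans (count-∨ (R y) (λ x → any (λ y → R y x) ys) xs)
      (ℕP.+-monoʳ-≤ (count (R y) xs) (count-any R ys xs))

    sum-mono : (f g : A → ℕ) (xs : List A) → All (λ x → f x ≤ g x) xs → sum (map f xs) ≤ sum (map g xs)
    sum-mono f g []       []           = z≤n
    sum-mono f g (x ∷ xs) (fx≤gx ∷ rest) = ℕP.+-mono-≤ fx≤gx (sum-mono f g xs rest)

    sum-scale : (k : ℕ) (f : A → ℕ) (xs : List A) → k * sum (map f xs) ≡ sum (map (λ x → k * f x) xs)
    sum-scale k f []       = ℕP.*-zeroʳ k
    sum-scale k f (x ∷ xs) = trans (ℕP.*-distribˡ-+ k (f x) _) (cong (k * f x +_) (sum-scale k f xs))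

    sum-indicator : (p : A → Bool) (b : ℕ) (xs : List A) →
      sum (map (λ x → if p x then b else 0) xs) ≡ count p xs * b
    sum-indicator p b []       = refl
    sum-indicator p b (x ∷ xs) with p x
    ... | true  = cong (b +_) (sum-indicator p b xs)
    ... | false = sum-indicator p b xs

  -- `# P` counts the assignments satisfying `P`, i.e. 2ⁿ · Pr[P] for a uniform assignment.
  # : ∀ {n} → (Assignment n → Bool) → ℕ
  # {n} P = count P (allAssignments n)

  #-mono : ∀ {n} {P Q : Assignment n → Bool} → (∀ σ → P σ ≡ true → Q σ ≡ true) → # P ≤ # Q
  #-mono {n} P⇒Q = count-mono P⇒Q (allAssignments n)

  #-cong : ∀ {n} {P Q : Assignment n → Bool} → (∀ σ → P σ ≡ Q σ) → # P ≡ # Q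
  #-cong {n} P≗Q = count-cong P≗Q (allAssignments n)

  restrict : ∀ {n} → Bool → (Assignment (suc n) → Bool) → Assignment n → Bool
  restrict b P σ = P (b ∷ᵥ σ)

  #-suc : ∀ {n} (P : Assignment (suc n) → Bool) → # P ≡ # (restrict true P) + # (restrict false P)
  #-suc {n} P = trans (count-++ P (map (true ∷ᵥ_) (allAssignments n)) (map (false ∷ᵥ_) (allAssignments n)))
    (cong₂ _+_ (count-map P (true ∷ᵥ_) (allAssignments n)) (count-map P (false ∷ᵥ_) (allAssignments n)))

  #-zero : (P : Assignment 0 → Bool) → # P ≡ (if P []ᵥ then 1 else 0)
  #-zero P = ℕP.+-identityʳ _

  #-pos : ∀ {n} (P : Assignment n → Bool) (σ : Assignment n) → P σ ≡ true → 0 < # P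
  #-pos {zero}  P []ᵥ         Pσ rewrite #-zero P | Pσ = s≤s z≤n
  #-pos {suc n} P (true ∷ᵥ σ)  Pσ rewrite #-suc P = ℕP.≤-trans (#-pos (restrict true P) σ Pσ) (ℕP.m≤m+n _ _)
  #-pos {suc n} P (false ∷ᵥ σ) Pσ rewrite #-suc P = ℕP.≤-trans (#-pos (restrict false P) σ Pσ) (ℕP.m≤n+m _ _)

  VarSet : ℕ → Set
  VarSet n = Fin n → Bool

  size : ∀ {n} → VarSet n → ℕ
  size {n} V = count V (allFin n)

  complement : ∀ {n} → VarSet n → VarSet n
  complement V j = not (V j)

  size-suc : ∀ {n} (V : VarSet (suc n)) → size V ≡ (if V zero then 1 else 0) + size (λ j → V (suc j))
  size-suc {n} V = cong ((if V zero then 1 else 0) +_) (begin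
    count V (tabulate suc)             ≡⟨ cong (count V) (sym (map-tabulate (λ j → j) suc)) ⟩
    count V (map suc (allFin n))       ≡⟨ count-map V suc (allFin n) ⟩
    count (λ j → V (suc j)) (allFin n) ∎)
    where open ≡-Reasoning

  Agree : ∀ {n} → VarSet n → Assignment n → Assignment n → Set
  Agree V σ τ = ∀ j → V j ≡ true → lookup σ j ≡ lookup τ j

  DependsOn : ∀ {n} → VarSet n → (Assignment n → Bool) → Set
  DependsOn V P = ∀ σ τ → Agree V σ τ → P σ ≡ P τ

  Determines : ∀ {n} → VarSet n → (Assignment n → Bool) → Set
  Determines V P = ∀ σ τ → P σ ≡ true → P τ ≡ true → Agree V σ τ

  restrict-dependsOn : ∀ {n} {V : VarSet (suc n)} {P} → DependsOn V P → (b : Bool) →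
    DependsOn (λ j → V (suc j)) (restrict b P)
  restrict-dependsOn P-dep b σ τ agree = P-dep (b ∷ᵥ σ) (b ∷ᵥ τ) λ { zero _ → refl ; (suc j) Vj → agree j Vj }

  restrict-determines : ∀ {n} {V : VarSet (suc n)} {P} → Determines V P → (b : Bool) →
    Determines (λ j → V (suc j)) (restrict b P)
  restrict-determines P-det b σ τ Pσ Pτ j = P-det (b ∷ᵥ σ) (b ∷ᵥ τ) Pσ Pτ (suc j)

  #-headFree : ∀ {n} {V : VarSet (suc n)} {P} → DependsOn V P → V zero ≡ false →
    # (restrict true P) ≡ # (restrict false P)
  #-headFree {V = V} {P} P-dep V0 = #-cong {P = restrict true P} {Q = restrict false P} λ σ →
    P-dep (true ∷ᵥ σ) (false ∷ᵥ σ) λ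
    { zero V0' → ⊥-elim (true≢false (trans (sym V0') V0)) ; (suc j) _ → refl }

  #-headPinned : ∀ {n} {V : VarSet (suc n)} {P} → Determines V P → V zero ≡ true →
    # (restrict true P) ≡ 0 ⊎ # (restrict false P) ≡ 0
  #-headPinned {n} {V} {P} P-det V0 with # (restrict true P) in #t
  ... | zero  = inj₁ refl
  ... | suc _ with (σ , _ , Pσ) ← count-witness (restrict true P) (allAssignments n) (subst (0 <_) (sym #t) (s≤s z≤n))
    = inj₂ (count-none (restrict false P) noFalse (allAssignments n))
    where
    noFalse : ∀ τ → P (false ∷ᵥ τ) ≡ false
    noFalse τ with P (false ∷ᵥ τ) in Pτ
    ... | false = refl
    ... | true  = ⊥-elim (true≢false (P-det (true ∷ᵥ σ) (false ∷ᵥ τ) Pσ Pτ zero V0))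

  module _ where
    open +-*-Solver

    merge : ∀ x y a c d m → x * m ≡ a * c → y * m ≡ a * d → (x + y) * (2 * m) ≡ (a + a) * (c + d)
    merge x y a c d m xm ym = begin
      (x + y) * (2 * m)           ≡⟨ solve 3 (λ x y m → (x :+ y) :* (con 2 :* m) := con 2 :* (x :* m :+ y :* m)) refl x y m ⟩
      2 * (x * m + y * m)         ≡⟨ cong₂ (λ u v → 2 * (u + v)) xm ym ⟩
      2 * (a * c + a * d)         ≡⟨ solve 3 (λ a c d → con 2 :* (a :* c :+ a :* d) := (a :+ a) :* (c :+ d)) refl a c d ⟩
      (a + a) * (c + d)           ∎
      where open ≡-Reasoning

  module Counts (n : ℕ) (P Q : Assignment (suc n) → Bool) where
    xt xf pt pf qt qf : ℕ
    xt = # (restrict true (λ σ → P σ ∧ Q σ))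
    xf = # (restrict false (λ σ → P σ ∧ Q σ))
    pt = # (restrict true P)
    pf = # (restrict false P)
    qt = # (restrict true Q)
    qf = # (restrict false Q)

  independent : ∀ n (V : VarSet n) (P Q : Assignment n → Bool) →
    DependsOn V P → DependsOn (complement V) Q → # (λ σ → P σ ∧ Q σ) * 2 ^ n ≡ # P * # Q
  independent zero V P Q _ _ rewrite #-zero (λ σ → P σ ∧ Q σ) | #-zero P | #-zero Q with P []ᵥ | Q []ᵥ
  ... | true  | true  = refl
  ... | true  | false = refl
  ... | false | true  = refl
  ... | false | false = refl
  independent (suc n) V P Q P-dep Q-dep
    rewrite #-suc (λ σ → P σ ∧ Q σ) | #-suc P | #-suc Q with V zero in V0
  ... | true  = begin
    (xt + xf) * (2 * 2 ^ n) ≡⟨ merge xt xf qt pt pf (2 ^ n) (trans (rec true) (ℕP.*-comm pt qt))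
                                 (trans (rec false) (trans (cong (pf *_) (sym Q-free)) (ℕP.*-comm pf qt))) ⟩
    (qt + qt) * (pt + pf)   ≡⟨ ℕP.*-comm (qt + qt) (pt + pf) ⟩
    (pt + pf) * (qt + qt)   ≡⟨ cong (λ q → (pt + pf) * (qt + q)) Q-free ⟩
    (pt + pf) * (qt + qf)   ∎
    where
    open ≡-Reasoning
    open Counts n P Q
    Q-free : qt ≡ qf
    Q-free = #-headFree {P = Q} Q-dep (cong not V0)
    rec : ∀ b → # (restrict b (λ σ → P σ ∧ Q σ)) * 2 ^ n ≡ # (restrict b P) * # (restrict b Q)
    rec b = independent n _ (restrict b P) (restrict b Q) (restrict-dependsOn P-dep b) (restrict-dependsOn Q-dep b)
  ... | false = begin
    (xt + xf) * (2 * 2 ^ n) ≡⟨ merge xt xf pt qt qf (2 ^ n) (rec true) (trans (rec false) (cong (_* qf) (sym P-free))) ⟩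
    (pt + pt) * (qt + qf)   ≡⟨ cong (λ p → (pt + p) * (qt + qf)) P-free ⟩
    (pt + pf) * (qt + qf)   ∎
    where
    open ≡-Reasoning
    open Counts n P Q
    P-free : pt ≡ pf
    P-free = #-headFree {P = P} P-dep V0
    rec : ∀ b → # (restrict b (λ σ → P σ ∧ Q σ)) * 2 ^ n ≡ # (restrict b P) * # (restrict b Q)
    rec b = independent n _ (restrict b P) (restrict b Q) (restrict-dependsOn P-dep b) (restrict-dependsOn Q-dep b)

  determined-bound : ∀ n (V : VarSet n) (P : Assignment n → Bool) →
    DependsOn V P → Determines V P → # P * 2 ^ size V ≤ 2 ^ n
  determined-bound zero V P _ _ rewrite #-zero P with P []ᵥ
  ... | true  = ℕP.≤-refl
  ... | false = z≤n
  determined-bound (suc n) V P P-dep P-det rewrite #-suc P | size-suc V with V zero in V0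
  ... | false = begin
    (pt + # (restrict false P)) * t ≡⟨ cong (λ p → (pt + p) * t) (sym (#-headFree {P = P} P-dep V0)) ⟩
    (pt + pt) * t                   ≡⟨ ℕP.*-distribʳ-+ t pt pt ⟩
    pt * t + pt * t                 ≤⟨ ℕP.+-mono-≤ (rec true) (rec true) ⟩
    2 ^ n + 2 ^ n                   ≡⟨ cong (2 ^ n +_) (sym (ℕP.+-identityʳ (2 ^ n))) ⟩
    2 * 2 ^ n                       ∎
    where
    open ℕP.≤-Reasoning
    t pt : ℕ
    t = 2 ^ size (λ j → V (suc j))
    pt = # (restrict true P)
    rec : ∀ b → # (restrict b P) * t ≤ 2 ^ n
    rec b = determined-bound n _ (restrict b P) (restrict-dependsOn P-dep b) (restrict-determines P-det b)
  ... | true = begin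
    (pt + pf) * (2 * t)             ≡⟨ ℕP.*-comm (pt + pf) (2 * t) ⟩
    2 * t * (pt + pf)               ≡⟨ ℕP.*-assoc 2 t (pt + pf) ⟩
    2 * (t * (pt + pf))             ≡⟨ cong (2 *_) (ℕP.*-comm t (pt + pf)) ⟩
    2 * ((pt + pf) * t)             ≤⟨ ℕP.*-monoʳ-≤ 2 one-side ⟩
    2 * 2 ^ n                       ∎
    where
    open ℕP.≤-Reasoning
    t pt pf : ℕ
    t = 2 ^ size (λ j → V (suc j))
    pt = # (restrict true P)
    pf = # (restrict false P)
    rec : ∀ b → # (restrict b P) * t ≤ 2 ^ n
    rec b = determined-bound n _ (restrict b P) (restrict-dependsOn P-dep b) (restrict-determines P-det b)
    one-side : (pt + pf) * t ≤ 2 ^ n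
    one-side with #-headPinned {P = P} P-det V0
    ... | inj₁ pt≡0 rewrite pt≡0 = rec false
    ... | inj₂ pf≡0 rewrite pf≡0 = subst (λ p → p * t ≤ 2 ^ n) (sym (ℕP.+-identityʳ pt)) (rec true)

  flipAt : ∀ {n} → Fin n → Assignment n → Assignment n
  flipAt zero    (b ∷ᵥ σ) = not b ∷ᵥ σ
  flipAt (suc i) (b ∷ᵥ σ) = b ∷ᵥ flipAt i σ

  lookup-flipAt-same : ∀ {n} (i : Fin n) σ → lookup (flipAt i σ) i ≡ not (lookup σ i)
  lookup-flipAt-same zero    (b ∷ᵥ σ) = refl
  lookup-flipAt-same (suc i) (b ∷ᵥ σ) = lookup-flipAt-same i σ

  lookup-flipAt-other : ∀ {n} (i j : Fin n) σ → ¬ (i ≡ j) → lookup (flipAt i σ) j ≡ lookup σ j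
  lookup-flipAt-other zero    zero    σ        i≢j = ⊥-elim (i≢j refl)
  lookup-flipAt-other zero    (suc j) (b ∷ᵥ σ) i≢j = refl
  lookup-flipAt-other (suc i) zero    (b ∷ᵥ σ) i≢j = refl
  lookup-flipAt-other (suc i) (suc j) (b ∷ᵥ σ) i≢j = lookup-flipAt-other i j σ (λ i≡j → i≢j (cong suc i≡j))

  -- Flipping a variable is a bijection on assignments, so it preserves counts.
  #-flipAt : ∀ {n} (i : Fin n) (P : Assignment n → Bool) → # (λ σ → P (flipAt i σ)) ≡ # P
  #-flipAt zero P rewrite #-suc (λ σ → P (flipAt zero σ)) | #-suc P =
    ℕP.+-comm (# (restrict false P)) (# (restrict true P))
  #-flipAt (suc i) P rewrite #-suc (λ σ → P (flipAt (suc i) σ)) | #-suc P =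
    cong₂ _+_ (#-flipAt i (restrict true P)) (#-flipAt i (restrict false P))

  flipAt-dependsOn : ∀ {n} (i : Fin n) {V P} → DependsOn V P → DependsOn V (λ σ → P (flipAt i σ))
  flipAt-dependsOn i {V} P-dep σ τ agree = P-dep (flipAt i σ) (flipAt i τ) agree′
    where
    agree′ : Agree V (flipAt i σ) (flipAt i τ)
    agree′ j Vj with i ≟ j
    ... | yes refl = trans (lookup-flipAt-same i σ) (trans (cong not (agree i Vj)) (sym (lookup-flipAt-same i τ)))
    ... | no i≢j   = trans (lookup-flipAt-other i j σ i≢j) (trans (agree j Vj) (sym (lookup-flipAt-other i j τ i≢j)))

  vars : ∀ {n} → Clause n → VarSet n
  vars c v = occurs v c

  numVars≡size : ∀ {n} (c : Clause n) → numVars c ≡ size (vars c)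
  numVars≡size {n} c = length-select (vars c) (allFin n)

  degree≡count : ∀ {n} (Φ : CNF n) (i : Fin n) → degree Φ i ≡ count (occurs i) Φ
  degree≡count Φ i = length-select (occurs i) Φ

  violated : ∀ {n} → Clause n → Assignment n → Bool
  violated c σ = not (evalClause σ c)

  sat : ∀ {n} → CNF n → Assignment n → Bool
  sat Φ σ = evalCNF σ Φ

  clause-dependsOn : ∀ {n} (c : Clause n) → DependsOn (vars c) (λ σ → evalClause σ c)
  clause-dependsOn []             σ τ agree = refl
  clause-dependsOn ((j , b) ∷ c) σ τ agree = cong₂ _∨_ (literal b) (clause-dependsOn c σ τ agree-tail)
    where
    agree-tail : Agree (vars c) σ τ
    agree-tail v occ = agree v (trans (cong (does (v ≟ j) ∨_) occ) (BoolP.∨-zeroʳ _))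
    agree-j : lookup σ j ≡ lookup τ j
    agree-j = agree j (cong (_∨ occurs j c) (dec-true (j ≟ j) refl))
    literal : ∀ b → evalLit σ (j , b) ≡ evalLit τ (j , b)
    literal true  = agree-j
    literal false = cong not agree-j

  violated-dependsOn : ∀ {n} (c : Clause n) → DependsOn (vars c) (violated c)
  violated-dependsOn c σ τ agree = cong not (clause-dependsOn c σ τ agree)

  violated-determines : ∀ {n} (c : Clause n) → Determines (vars c) (violated c)
  violated-determines []             σ τ _  _  v ()
  violated-determines ((j , b) ∷ c) σ τ σ✗ τ✗ v occ
    with evalLit σ (j , b) in σj | evalLit τ (j , b) in τj | v ≟ j
  ... | false | false | yes refl = literal b σj τj
    where
    literal : ∀ b → evalLit σ (j , b) ≡ false → evalLit τ (j , b) ≡ false → lookup σ j ≡ lookup τ j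
    literal true  σj τj = trans σj (sym τj)
    literal false σj τj = BoolP.not-injective (trans σj (sym τj))
  ... | false | false | no _ = violated-determines c σ τ σ✗ τ✗ v occ

  any-intro : ∀ {A : Set} (p : A → Bool) {x : A} {xs : List A} → x ∈ xs → p x ≡ true → any p xs ≡ true
  any-intro p {xs = y ∷ ys} (here refl) px = cong (_∨ any p ys) px
  any-intro p {xs = y ∷ ys} (there x∈ys) px = trans (cong (p y ∨_) (any-intro p x∈ys px)) (BoolP.∨-zeroʳ (p y))

  meets : ∀ {n} → VarSet n → Clause n → Bool
  meets {n} V c = any (λ v → V v ∧ occurs v c) (allFin n)

  sat-dependsOn-complement : ∀ {n} (V : VarSet n) (S : CNF n) →
    All (λ c → not (meets V c) ≡ true) S → DependsOn (complement V) (sat S)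
  sat-dependsOn-complement V []      []               σ τ agree = refl
  sat-dependsOn-complement V (c ∷ S) (c-avoids ∷ rest) σ τ agree =
    cong₂ _∧_ (clause-dependsOn c σ τ agree-c) (sat-dependsOn-complement V S rest σ τ agree)
    where
    agree-c : Agree (vars c) σ τ
    agree-c v occ with V v in Vv
    ... | false = agree v (cong not Vv)
    ... | true  = ⊥-elim (true≢false (trans (sym c-avoids)
                    (cong not (any-intro (λ v → V v ∧ occurs v c) (∈-allFin v) (cong₂ _∧_ Vv occ)))))

  sat-++ : ∀ {n} (L R : CNF n) σ → sat (L ++ R) σ ≡ sat L σ ∧ sat R σ
  sat-++ L R σ = all-++ (evalClause σ) L R

  -- Each clause meeting V contains a variable of V, so at most |V| · d clauses meet V.
  meeting-count : ∀ {n} (V : VarSet n) (S : CNF n) (d : ℕ) → (∀ v → count (occurs v) S ≤ d) →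
    count (meets V) S ≤ size V * d
  meeting-count {n} V S d deg = begin
    count (meets V) S
      ≤⟨ count-any (λ v c → V v ∧ occurs v c) (allFin n) S ⟩
    sum (map (λ v → count (λ c → V v ∧ occurs v c) S) (allFin n))
      ≤⟨ sum-mono _ _ (allFin n) (All.universal per-variable (allFin n)) ⟩
    sum (map (λ v → if V v then d else 0) (allFin n))
      ≡⟨ sum-indicator V d (allFin n) ⟩
    size V * d ∎
    where
    open ℕP.≤-Reasoning
    per-variable : ∀ v → count (λ c → V v ∧ occurs v c) S ≤ (if V v then d else 0)
    per-variable v with V v
    ... | true  = deg v
    ... | false = ℕP.≤-reflexive (count-none _ (λ _ → refl) S)

  lit : ∀ {n} → Fin n → Bool → Assignment n → Bool
  lit i b σ = evalLit σ (i , b)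

  lit-flipAt : ∀ {n} (i : Fin n) b σ → lit i (not b) (flipAt i σ) ≡ lit i b σ
  lit-flipAt i true  σ = trans (cong not (lookup-flipAt-same i σ)) (BoolP.not-involutive (lookup σ i))
  lit-flipAt i false σ = lookup-flipAt-same i σ

  flip-breaks : ∀ {n} (i : Fin n) σ (L : CNF n) → sat L σ ≡ true → sat L (flipAt i σ) ≡ false →
    any (λ c → occurs i c ∧ violated c (flipAt i σ)) L ≡ true
  flip-breaks i σ (c ∷ L) L✓ flip✗ with evalClause (flipAt i σ) c in c-flip | occurs i c in i∈c
  ... | true  | _     = trans (cong (_ ∨_) (flip-breaks i σ L (BoolP.∧-conicalʳ _ _ L✓) flip✗)) (BoolP.∨-zeroʳ _)
  ... | false | true  = refl
  ... | false | false = ⊥-elim (true≢false (trans (sym (BoolP.∧-conicalˡ _ _ L✓))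
                          (trans (clause-dependsOn c σ (flipAt i σ) unflipped) c-flip)))
    where
    unflipped : Agree (vars c) σ (flipAt i σ)
    unflipped v v∈c with i ≟ v
    ... | yes refl = ⊥-elim (true≢false (trans (sym v∈c) i∈c))
    ... | no i≢v   = sym (lookup-flipAt-other i v σ i≢v)

  module _ where
    open +-*-Solver
    open ℕP.≤-Reasoning

    -- Arithmetic of one peeling step: removing a clause costs at most 2/K of the remaining mass.
    peel-step : ∀ K a b c x l → a ≡ b + c → K * c ≤ 2 * a → a ≤ x → K * x ≤ K * a + 2 * l * x →
      K * x ≤ K * b + 2 * suc l * x
    peel-step K a b c x l a≡b+c Kc≤2a a≤x IH = begin
      K * x                       ≤⟨ IH ⟩
      K * a + 2 * l * x           ≡⟨ cong (λ z → K * z + 2 * l * x) a≡b+c ⟩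
      K * (b + c) + 2 * l * x     ≡⟨ solve 5 (λ K b c l x → K :* (b :+ c) :+ con 2 :* l :* x := K :* b :+ K :* c :+ con 2 :* l :* x) refl K b c l x ⟩
      K * b + K * c + 2 * l * x   ≤⟨ ℕP.+-monoˡ-≤ (2 * l * x) (ℕP.+-monoʳ-≤ (K * b) (ℕP.≤-trans Kc≤2a (ℕP.*-monoʳ-≤ 2 a≤x))) ⟩
      K * b + 2 * x + 2 * l * x   ≡⟨ solve 4 (λ K b l x → K :* b :+ con 2 :* x :+ con 2 :* l :* x := K :* b :+ con 2 :* (con 1 :+ l) :* x) refl K b l x ⟩
      K * b + 2 * suc l * x       ∎

    -- If at most K/4 clauses were peeled, the mass at most halved.
    halve : ∀ K x y l → 1 ≤ K → 4 * l ≤ K → K * x ≤ K * y + 2 * l * x → x ≤ 2 * y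
    halve K x y l K>0 4l≤K peeled = ℕP.*-cancelˡ-≤ K {{>-nonZero K>0}} (ℕP.+-cancelʳ-≤ (K * x) (K * x) (K * (2 * y)) (begin
      K * x + K * x               ≡⟨ solve 2 (λ K x → K :* x :+ K :* x := con 2 :* (K :* x)) refl K x ⟩
      2 * (K * x)                 ≤⟨ ℕP.*-monoʳ-≤ 2 peeled ⟩
      2 * (K * y + 2 * l * x)     ≡⟨ solve 4 (λ K y l x → con 2 :* (K :* y :+ con 2 :* l :* x) := K :* (con 2 :* y) :+ con 4 :* l :* x) refl K y l x ⟩
      K * (2 * y) + 4 * l * x     ≤⟨ ℕP.+-monoʳ-≤ (K * (2 * y)) (ℕP.*-monoˡ-≤ x 4l≤K) ⟩
      K * (2 * y) + K * x         ∎))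

    -- From Pr[A ∧ S] ≤ Pr[A] · 2 Pr[S] and Pr[A] ≤ 1/K conclude K · #(A ∧ S) ≤ 2 · #S.
    scale : ∀ K x a s P → 1 ≤ P → x * P ≤ a * (2 * s) → a * K ≤ P → K * x ≤ 2 * s
    scale K x a s P P>0 x≤ aK≤P = ℕP.*-cancelʳ-≤ (K * x) (2 * s) P {{>-nonZero P>0}} (begin
      K * x * P                   ≡⟨ ℕP.*-assoc K x P ⟩
      K * (x * P)                 ≤⟨ ℕP.*-monoʳ-≤ K x≤ ⟩
      K * (a * (2 * s))           ≡⟨ solve 3 (λ K a t → K :* (a :* t) := (a :* K) :* t) refl K a (2 * s) ⟩
      a * K * (2 * s)             ≤⟨ ℕP.*-monoˡ-≤ (2 * s) aK≤P ⟩
      P * (2 * s)                 ≡⟨ ℕP.*-comm P (2 * s) ⟩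
      2 * s * P                   ∎)

  module ConditionalBound {n : ℕ} (K M d : ℕ) (K>0 : 1 ≤ K) (4Md≤K : 4 * (M * d) ≤ K) where

    Admissible : Clause n → Set
    Admissible c = K ≤ 2 ^ size (vars c) × size (vars c) ≤ M

    Bounded : CNF n → Set
    Bounded S = All Admissible S × (∀ v → count (occurs v) S ≤ d)

    Rare : (Assignment n → Bool) → Set
    Rare A = Σ (VarSet n) λ V → DependsOn V A × size V ≤ M × # A * K ≤ 2 ^ n

    solutions : CNF n → ℕ
    solutions S = # (sat S)

    CondBound : CNF n → Set
    CondBound S = ∀ A → Rare A → K * # (λ σ → A σ ∧ sat S σ) ≤ 2 * solutions S

    CondBoundBelow : ℕ → Set
    CondBoundBelow m = ∀ S → length S < m → Bounded S → CondBound S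

    violated-rare : ∀ c → Admissible c → Rare (violated c)
    violated-rare c (K≤2^|c| , |c|≤M) = vars c , violated-dependsOn c , |c|≤M ,
      ℕP.≤-trans (ℕP.*-monoʳ-≤ (# (violated c)) K≤2^|c|)
        (determined-bound n (vars c) (violated c) (violated-dependsOn c) (violated-determines c))

    bounded-tail : ∀ {c S} → Bounded (c ∷ S) → Bounded S
    bounded-tail (_ ∷ adm , deg) = adm , λ v → ℕP.≤-trans (ℕP.m≤n+m _ _) (deg v)

    -- Peeling the clauses of L off L ++ R one at a time, each removal loses at most
    -- 2/K of the mass of R (by CondBound for the shorter formula).
    peel : ∀ m → CondBoundBelow m → ∀ L R → length (L ++ R) ≤ m → Bounded (L ++ R) →
      K * solutions R ≤ K * solutions (L ++ R) + 2 * length L * solutions R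
    peel m below []      R _   _       = ℕP.≤-reflexive (sym (ℕP.+-identityʳ _))
    peel m below (B ∷ L) R len bounded@(B-adm ∷ _ , _) =
      peel-step K (solutions (L ++ R)) (solutions (B ∷ L ++ R)) (# (λ σ → violated B σ ∧ sat (L ++ R) σ)) (solutions R) (length L)
        (count-split (λ σ → evalClause σ B) (sat (L ++ R)) (allAssignments n))
        (below (L ++ R) len (bounded-tail bounded) (violated B) (violated-rare B B-adm))
        (#-mono λ σ LR → BoolP.∧-conicalʳ (sat L σ) (sat R σ) (trans (sym (sat-++ L R σ)) LR))
        (peel m below L R (ℕP.≤-trans (ℕP.n≤1+n _) len) (bounded-tail bounded))

    near far : VarSet n → CNF n → CNF n
    near V S = select (meets V) S
    far  V S = select (λ c → not (meets V c)) S

    module _ (V : VarSet n) (S : CNF n) where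

      sat-near-far : ∀ σ → sat S σ ≡ sat (near V S) σ ∧ sat (far V S) σ
      sat-near-far σ = all-partition (meets V) (evalClause σ) S

      solutions-rearranged : solutions (near V S ++ far V S) ≡ solutions S
      solutions-rearranged = #-cong λ σ → trans (sat-++ (near V S) (far V S) σ) (sym (sat-near-far σ))

      length-rearranged : length (near V S ++ far V S) ≡ length S
      length-rearranged = begin
        length (near V S ++ far V S)                                    ≡⟨ length-++ (near V S) ⟩
        length (near V S) + length (far V S)                            ≡⟨ cong₂ _+_ (length≡count (near V S)) (length≡count (far V S)) ⟩
        count (λ _ → true) (near V S) + count (λ _ → true) (far V S)    ≡⟨ count-partition (meets V) (λ _ → true) S ⟩
        count (λ _ → true) S                                            ≡⟨ sym (length≡count S) ⟩
        length S                                                        ∎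
        where open ≡-Reasoning

      bounded-rearranged : Bounded S → Bounded (near V S ++ far V S)
      bounded-rearranged (adm , deg) =
        AllP.++⁺ (AllP.filter⁺ _ adm) (AllP.filter⁺ _ adm) ,
        λ v → subst (_≤ d) (sym (trans (count-++ (occurs v) (near V S) (far V S)) (count-partition (meets V) (occurs v) S))) (deg v)

    far-mass : ∀ S → CondBoundBelow (length S) → Bounded S → ∀ V → count (meets V) S ≤ M * d →
      solutions (far V S) ≤ 2 * solutions S
    far-mass S below bounded V few-near = halve K (solutions (far V S)) (solutions S) (length (near V S)) K>0 4|near|≤K
      (subst (λ x → K * solutions (far V S) ≤ K * x + 2 * length (near V S) * solutions (far V S)) (solutions-rearranged V S)
        (peel (length S) below (near V S) (far V S) (ℕP.≤-reflexive (length-rearranged V S)) (bounded-rearranged V S bounded)))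
      where
      4|near|≤K : 4 * length (near V S) ≤ K
      4|near|≤K = ℕP.≤-trans (ℕP.*-monoʳ-≤ 4 (subst (_≤ M * d) (sym (length-select (meets V) S)) few-near)) 4Md≤K

    -- The inductive step: a rare event A on V is independent of the clauses far from V,
    -- and dropping the clauses near V costs at most a factor 2.
    cond-bound-step : ∀ S → CondBoundBelow (length S) → Bounded S → CondBound S
    cond-bound-step S below bounded@(_ , deg) A (V , A-dep , |V|≤M , A-rare) =
      scale K (# (λ σ → A σ ∧ sat S σ)) (# A) (solutions S) (2 ^ n) (ℕP.m^n>0 2 n) joint A-rare
      where
      open ℕP.≤-Reasoning
      joint : # (λ σ → A σ ∧ sat S σ) * 2 ^ n ≤ # A * (2 * solutions S)
      joint = begin
        # (λ σ → A σ ∧ sat S σ) * 2 ^ n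
          ≤⟨ ℕP.*-monoˡ-≤ (2 ^ n) (#-mono {P = λ σ → A σ ∧ sat S σ} {Q = λ σ → A σ ∧ sat (far V S) σ}
                λ σ → ∧-weakenʳ (A σ) λ S✓ → BoolP.∧-conicalʳ _ _ (trans (sym (sat-near-far V S σ)) S✓)) ⟩
        # (λ σ → A σ ∧ sat (far V S) σ) * 2 ^ n
          ≡⟨ independent n V A (sat (far V S)) A-dep (sat-dependsOn-complement V (far V S) (AllP.all-filter _ S)) ⟩
        # A * solutions (far V S)
          ≤⟨ ℕP.*-monoʳ-≤ (# A) (far-mass S below bounded V
                (ℕP.≤-trans (meeting-count V S d deg) (ℕP.*-monoˡ-≤ d |V|≤M))) ⟩
        # A * (2 * solutions S) ∎

    cond-bound-below : ∀ m → CondBoundBelow m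
    cond-bound-below zero    S ()
    cond-bound-below (suc m) S |S|<1+m =
      cond-bound-step S (λ S′ |S′|<|S| → cond-bound-below m S′ (ℕP.<-≤-trans |S′|<|S| (ℕP.≤-pred |S|<1+m)))

    cond-bound : ∀ S → Bounded S → CondBound S
    cond-bound S = cond-bound-below (suc (length S)) S ℕP.≤-refl

    -- A solution of Φ with x_i = b either stays a solution when x_i is flipped
    -- (becoming a solution with x_i = ¬b), or the flip violates a clause containing x_i;
    -- each such clause accounts for at most 2/K of the solutions.
    module _ (Φ : CNF n) (Φ-bounded : Bounded Φ) (i : Fin n) where

      broken-by-flip : Clause n → Assignment n → Bool
      broken-by-flip c σ = sat Φ σ ∧ (occurs i c ∧ violated c (flipAt i σ))

      flip-count : ∀ b → # (λ σ → sat Φ σ ∧ lit i b σ) ≤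
        # (λ σ → sat Φ σ ∧ lit i (not b) σ) + sum (map (λ c → # (broken-by-flip c)) Φ)
      flip-count b = begin
        # (λ σ → sat Φ σ ∧ lit i b σ)
          ≤⟨ #-mono {P = λ σ → sat Φ σ ∧ lit i b σ} {Q = λ σ → Sol (flipAt i σ) ∨ broken σ} flip-or-break ⟩
        # (λ σ → Sol (flipAt i σ) ∨ broken σ)
          ≤⟨ count-∨ (λ σ → Sol (flipAt i σ)) broken (allAssignments n) ⟩
        # (λ σ → Sol (flipAt i σ)) + # broken
          ≤⟨ ℕP.+-mono-≤ (ℕP.≤-reflexive (#-flipAt i Sol)) (count-any broken-by-flip Φ (allAssignments n)) ⟩
        # Sol + sum (map (λ c → # (broken-by-flip c)) Φ) ∎
        where
        open ℕP.≤-Reasoning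
        Sol : Assignment n → Bool
        Sol σ = sat Φ σ ∧ lit i (not b) σ
        broken : Assignment n → Bool
        broken σ = any (λ c → broken-by-flip c σ) Φ
        flip-or-break : ∀ σ → sat Φ σ ∧ lit i b σ ≡ true → Sol (flipAt i σ) ∨ broken σ ≡ true
        flip-or-break σ sol with sat Φ σ in σ✓ | sat Φ (flipAt i σ) in flip✓
        ... | true | true  = cong (_∨ _) (trans (lit-flipAt i b σ) sol)
        ... | true | false = flip-breaks i σ Φ σ✓ flip✓

      -- A clause c ∋ x_i violated after the flip is a rare event, so it breaks few solutions.
      broken-bound : ∀ c → Admissible c → K * # (broken-by-flip c) ≤ (if occurs i c then 2 * solutions Φ else 0)
      broken-bound c adm with occurs i c
      ... | false = ℕP.≤-reflexive (trans (cong (K *_) (count-none _ (λ σ → BoolP.∧-zeroʳ (sat Φ σ)) (allAssignments n)))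
                                          (ℕP.*-zeroʳ K))
      ... | true  = subst (λ x → K * x ≤ 2 * solutions Φ) (#-cong λ σ → BoolP.∧-comm (violated c (flipAt i σ)) (sat Φ σ))
                      (cond-bound Φ Φ-bounded (λ σ → violated c (flipAt i σ)) flipped-rare)
        where
        flipped-rare : Rare (λ σ → violated c (flipAt i σ))
        flipped-rare with (_ , _ , _ , c-rare) ← violated-rare c adm =
          vars c , flipAt-dependsOn i (violated-dependsOn c) , proj₂ adm ,
          subst (λ x → x * K ≤ 2 ^ n) (sym (#-flipAt i (violated c))) c-rare

      flip-bound : ∀ b → K * # (λ σ → sat Φ σ ∧ lit i b σ) ≤
        K * # (λ σ → sat Φ σ ∧ lit i (not b) σ) + count (occurs i) Φ * (2 * solutions Φ)
      flip-bound b = begin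
        K * # (λ σ → sat Φ σ ∧ lit i b σ)
          ≤⟨ ℕP.*-monoʳ-≤ K (flip-count b) ⟩
        K * (# (λ σ → sat Φ σ ∧ lit i (not b) σ) + sum (map (λ c → # (broken-by-flip c)) Φ))
          ≡⟨ ℕP.*-distribˡ-+ K _ _ ⟩
        K * # (λ σ → sat Φ σ ∧ lit i (not b) σ) + K * sum (map (λ c → # (broken-by-flip c)) Φ)
          ≤⟨ ℕP.+-monoʳ-≤ _ all-broken ⟩
        K * # (λ σ → sat Φ σ ∧ lit i (not b) σ) + count (occurs i) Φ * (2 * solutions Φ) ∎
        where
        open ℕP.≤-Reasoning
        all-broken : K * sum (map (λ c → # (broken-by-flip c)) Φ) ≤ count (occurs i) Φ * (2 * solutions Φ)
        all-broken = begin
          K * sum (map (λ c → # (broken-by-flip c)) Φ)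
            ≡⟨ sum-scale K (λ c → # (broken-by-flip c)) Φ ⟩
          sum (map (λ c → K * # (broken-by-flip c)) Φ)
            ≤⟨ sum-mono _ _ Φ (All.map (λ {c} → broken-bound c) (proj₁ Φ-bounded)) ⟩
          sum (map (λ c → if occurs i c then 2 * solutions Φ else 0) Φ)
            ≡⟨ sum-indicator (occurs i) (2 * solutions Φ) Φ ⟩
          count (occurs i) Φ * (2 * solutions Φ) ∎

  -- Arithmetic turning the flip bound into the ratio bound; s = sa / sb.
  module _ where
    open +-*-Solver
    open ℕP.≤-Reasoning

    -- If s ≤ 4 then 1/2 + 2/s ≥ 1, so any share X ≤ N is within the bound.
    share-small : ∀ X N sa sb → sa ≤ 4 * sb → X ≤ N → X * (2 * sa) ≤ (sa + 4 * sb) * N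
    share-small X N sa sb sa≤4sb X≤N = begin
      X * (2 * sa)      ≤⟨ ℕP.*-monoˡ-≤ (2 * sa) X≤N ⟩
      N * (2 * sa)      ≡⟨ solve 2 (λ N s → N :* (con 2 :* s) := (s :+ s) :* N) refl N sa ⟩
      (sa + sa) * N     ≤⟨ ℕP.*-monoˡ-≤ N (ℕP.+-monoʳ-≤ sa sa≤4sb) ⟩
      (sa + 4 * sb) * N ∎

    large-K : ∀ K D sa sb → 1 ≤ sb → 5 * D * sa ≤ K * (2 * sb) → 4 * sb < sa → 4 * D ≤ K
    large-K K D sa sb sb>0 hyp 4sb<sa = ℕP.*-cancelʳ-≤ (4 * D) K (2 * sb) {{>-nonZero (ℕP.≤-trans sb>0 (ℕP.m≤n*m sb 2))}} (begin
      4 * D * (2 * sb)  ≤⟨ ℕP.*-monoˡ-≤ (2 * sb) (ℕP.m≤m+n (4 * D) (D * 6)) ⟩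
      (4 * D + D * 6) * (2 * sb) ≡⟨ solve 2 (λ D b → (con 4 :* D :+ D :* con 6) :* (con 2 :* b) := con 5 :* D :* (con 4 :* b)) refl D sb ⟩
      5 * D * (4 * sb)  ≤⟨ ℕP.*-monoʳ-≤ (5 * D) (ℕP.<⇒≤ 4sb<sa) ⟩
      5 * D * sa        ≤⟨ hyp ⟩
      K * (2 * sb)      ∎)

    share-large : ∀ K X Y N m D sa sb → 1 ≤ K → X + Y ≡ N → K * X ≤ K * Y + m * (2 * N) → 2 * m ≤ D →
      5 * D * sa ≤ K * (2 * sb) → X * (2 * sa) ≤ (sa + 4 * sb) * N
    share-large K X Y .(X + Y) m D sa sb K>0 refl flip 2m≤D hyp = ℕP.*-cancelˡ-≤ K {{>-nonZero K>0}} (begin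
      K * (X * (2 * sa))                                ≡⟨ solve 3 (λ K X s → K :* (X :* (con 2 :* s)) := (K :* X :+ K :* X) :* s) refl K X sa ⟩
      (K * X + K * X) * sa                              ≤⟨ ℕP.*-monoˡ-≤ sa (ℕP.+-monoʳ-≤ (K * X) flip) ⟩
      (K * X + (K * Y + m * (2 * (X + Y)))) * sa        ≡⟨ solve 5 (λ K X Y m s → (K :* X :+ (K :* Y :+ m :* (con 2 :* (X :+ Y)))) :* s := K :* (X :+ Y) :* s :+ (con 2 :* m :* s) :* (X :+ Y)) refl K X Y m sa ⟩
      K * (X + Y) * sa + (2 * m * sa) * (X + Y)         ≤⟨ ℕP.+-monoʳ-≤ (K * (X + Y) * sa) (ℕP.*-monoˡ-≤ (X + Y) 2msa≤4Ksb) ⟩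
      K * (X + Y) * sa + (4 * K * sb) * (X + Y)         ≡⟨ solve 5 (λ K X Y s b → K :* (X :+ Y) :* s :+ (con 4 :* K :* b) :* (X :+ Y) := K :* ((s :+ con 4 :* b) :* (X :+ Y))) refl K X Y sa sb ⟩
      K * ((sa + 4 * sb) * (X + Y))                     ∎)
      where
      2msa≤4Ksb : 2 * m * sa ≤ 4 * K * sb
      2msa≤4Ksb = begin
        2 * m * sa                          ≤⟨ ℕP.m≤m+n (2 * m * sa) (4 * (2 * m * sa)) ⟩
        2 * m * sa + 4 * (2 * m * sa)       ≡⟨ solve 2 (λ m s → con 2 :* m :* s :+ con 4 :* (con 2 :* m :* s) := con 5 :* (con 2 :* m) :* s) refl m sa ⟩
        5 * (2 * m) * sa                    ≤⟨ ℕP.*-monoˡ-≤ sa (ℕP.*-monoʳ-≤ 5 2m≤D) ⟩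
        5 * D * sa                          ≤⟨ hyp ⟩
        K * (2 * sb)                        ≤⟨ ℕP.m≤m+n (K * (2 * sb)) (K * (2 * sb)) ⟩
        K * (2 * sb) + K * (2 * sb)         ≡⟨ solve 2 (λ K b → K :* (con 2 :* b) :+ K :* (con 2 :* b) := con 4 :* K :* b) refl K sb ⟩
        4 * K * sb                          ∎

    -- For N = X + Y, the upper bound for the complementary share Y is the lower bound for X.
    complement-share : ∀ X Y N sa sb → X + Y ≡ N → Y * (2 * sa) ≤ (sa + 4 * sb) * N →
      sa * N ≤ 2 * X * sa + 4 * sb * N
    complement-share X Y .(X + Y) sa sb refl upper = ℕP.+-cancelˡ-≤ (sa * (X + Y)) _ _ (begin
      sa * (X + Y) + sa * (X + Y)               ≡⟨ solve 3 (λ X Y s → s :* (X :+ Y) :+ s :* (X :+ Y) := con 2 :* X :* s :+ Y :* (con 2 :* s)) refl X Y sa ⟩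
      2 * X * sa + Y * (2 * sa)                 ≤⟨ ℕP.+-monoʳ-≤ (2 * X * sa) upper ⟩
      2 * X * sa + (sa + 4 * sb) * (X + Y)      ≡⟨ solve 4 (λ X Y s b → con 2 :* X :* s :+ (s :+ con 4 :* b) :* (X :+ Y) := s :* (X :+ Y) :+ (con 2 :* X :* s :+ con 4 :* b :* (X :+ Y))) refl X Y sa sb ⟩
      sa * (X + Y) + (2 * X * sa + 4 * sb * (X + Y)) ∎)

  2≤C : ∀ {C} → C ≡ 2 ⊎ C ≡ 6 → 2 ≤ C
  2≤C (inj₁ refl) = ℕP.≤-refl
  2≤C (inj₂ refl) = s≤s (s≤s z≤n)

  module Bias (C n k d : ℕ) (C∈ : C ≡ 2 ⊎ C ≡ 6) (Φ : CNF n)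
    (clause-sizes : All (λ c → k ≤ numVars c × numVars c ≤ C * k) Φ)
    (degrees : ∀ (v : Fin n) → degree Φ v ≤ d) (i : Fin n) where

    K M D : ℕ
    K = 2 ^ k
    M = C * k
    D = C * d * k

    share : Bool → ℕ
    share b = # (λ σ → sat Φ σ ∧ lit i b σ)

    shares : ∀ b → # (sat Φ) ≡ share b + share (not b)
    shares b = trans (count-split (lit i b) (sat Φ) (allAssignments n))
      (cong₂ _+_ (#-cong λ σ → BoolP.∧-comm (lit i b σ) (sat Φ σ))
                 (#-cong λ σ → trans (cong (_∧ sat Φ σ) (not-lit b σ)) (BoolP.∧-comm (lit i (not b) σ) (sat Φ σ))))
      where
      not-lit : ∀ b σ → not (lit i b σ) ≡ lit i (not b) σ
      not-lit true  σ = refl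
      not-lit false σ = BoolP.not-involutive _

    -- x_i occurring in some clause forces k ≥ 1, since that clause has at most C·k variables.
    k>0 : 0 < count (occurs i) Φ → 0 < k
    k>0 deg>0 with (c , c∈Φ , i∈c) ← count-witness (occurs i) Φ deg>0 =
      >-nonZero⁻¹ k {{ℕP.m*n≢0⇒n≢0 C {{>-nonZero Ck>0}}}}
      where
      Ck>0 : 0 < C * k
      Ck>0 = ℕP.<-≤-trans (subst (0 <_) (sym (numVars≡size c)) (count-pos (vars c) (∈-allFin i) i∈c))
                          (proj₂ (All.lookup clause-sizes c∈Φ))

    2deg≤D : 2 * count (occurs i) Φ ≤ D
    2deg≤D with count (occurs i) Φ in deg-i
    ... | zero  = z≤n
    ... | suc m = begin
      2 * suc m   ≤⟨ ℕP.*-monoʳ-≤ 2 (subst (_≤ d) (trans (degree≡count Φ i) deg-i) (degrees i)) ⟩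
      2 * d       ≤⟨ ℕP.*-monoˡ-≤ d (2≤C C∈) ⟩
      C * d       ≡⟨ sym (ℕP.*-identityʳ (C * d)) ⟩
      C * d * 1   ≤⟨ ℕP.*-monoʳ-≤ (C * d) (k>0 (subst (0 <_) (sym deg-i) (s≤s z≤n))) ⟩
      C * d * k   ∎
      where
      open ℕP.≤-Reasoning

    share-bound : ∀ sa sb → 1 ≤ sb → 5 * D * sa ≤ K * (2 * sb) → ∀ b N → # (sat Φ) ≡ N →
      share b * (2 * sa) ≤ (sa + 4 * sb) * N
    share-bound sa sb sb>0 hyp b N N≡ with sa ≤? 4 * sb
    ... | yes sa≤4sb = share-small (share b) N sa sb sa≤4sb
                         (ℕP.≤-trans (ℕP.m≤m+n (share b) (share (not b))) (ℕP.≤-reflexive (trans (sym (shares b)) N≡)))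
    ... | no  sa≰4sb = share-large K (share b) (share (not b)) N (count (occurs i) Φ) D sa sb K>0
                         (trans (sym (shares b)) N≡) flip 2deg≤D hyp
      where
      K>0 : 1 ≤ K
      K>0 = ℕP.m^n>0 2 k
      4Md≤K : 4 * (M * d) ≤ K
      4Md≤K = subst (λ x → 4 * x ≤ K) (D≡Md) (large-K K D sa sb sb>0 hyp (ℕP.≰⇒> sa≰4sb))
        where
        open +-*-Solver
        D≡Md : D ≡ M * d
        D≡Md = solve 3 (λ C d k → C :* d :* k := C :* k :* d) refl C d k
      open ConditionalBound {n} K M d K>0 4Md≤K
      bounded : Bounded Φ
      bounded = All.map (λ {c} → admissible c) clause-sizes , λ v → subst (_≤ d) (degree≡count Φ v) (degrees v)
        where
        admissible : ∀ c → k ≤ numVars c × numVars c ≤ C * k → Admissible c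
        admissible c (k≤|c| , |c|≤M) = ℕP.^-monoʳ-≤ 2 (subst (k ≤_) (numVars≡size c) k≤|c|) ,
                                       subst (_≤ M) (numVars≡size c) |c|≤M
      flip : K * share b ≤ K * share (not b) + count (occurs i) Φ * (2 * N)
      flip = subst (λ x → K * share b ≤ K * share (not b) + count (occurs i) Φ * (2 * x)) N≡
               (flip-bound Φ bounded i b)

  -- Rational arithmetic, done on unnormalised fractions and compared by cross-multiplication.
  module Fractions where

    open ℤ using (+_)

    -- `frac x y` is the unnormalised fraction x / (1 + y).
    frac : ℕ → ℕ → ℚᵘ
    frac x y = mkℚᵘ (+ x) y

    frac-≤ : ∀ x₁ y₁ x₂ y₂ → x₁ ℕ.* suc y₂ ℕ.≤ x₂ ℕ.* suc y₁ → frac x₁ y₁ ℚᵘ.≤ frac x₂ y₂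
    frac-≤ x₁ y₁ x₂ y₂ h = ℚᵘ.*≤* (subst₂ ℤ._≤_ (ℤP.pos-* x₁ (suc y₂)) (ℤP.pos-* x₂ (suc y₁)) (ℤ.+≤+ h))

    frac-≤⁻¹ : ∀ x₁ y₁ x₂ y₂ → frac x₁ y₁ ℚᵘ.≤ frac x₂ y₂ → x₁ ℕ.* suc y₂ ℕ.≤ x₂ ℕ.* suc y₁
    frac-≤⁻¹ x₁ y₁ x₂ y₂ h =
      ℤP.drop‿+≤+ (subst₂ ℤ._≤_ (sym (ℤP.pos-* x₁ (suc y₂))) (sym (ℤP.pos-* x₂ (suc y₁))) (ℚᵘP.drop-*≤* h))

    frac-* : ∀ x₁ y₁ x₂ y₂ → frac x₁ y₁ ℚᵘ.* frac x₂ y₂ ≡ frac (x₁ ℕ.* x₂) (y₂ ℕ.+ y₁ ℕ.* suc y₂)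
    frac-* x₁ y₁ x₂ y₂ = cong (λ z → mkℚᵘ z (y₂ ℕ.+ y₁ ℕ.* suc y₂)) (sym (ℤP.pos-* x₁ x₂))

    frac-+ : ∀ x₁ y₁ x₂ y₂ →
      frac x₁ y₁ ℚᵘ.+ frac x₂ y₂ ≡ frac (x₁ ℕ.* suc y₂ ℕ.+ x₂ ℕ.* suc y₁) (y₂ ℕ.+ y₁ ℕ.* suc y₂)
    frac-+ x₁ y₁ x₂ y₂ = cong (λ z → mkℚᵘ z (y₂ ℕ.+ y₁ ℕ.* suc y₂))
      (cong₂ ℤ._+_ (sym (ℤP.pos-* x₁ (suc y₂))) (sym (ℤP.pos-* x₂ (suc y₁))))

    toℚᵘ-/ : ∀ x y → ℚ.toℚᵘ ((+ x) / suc y) ≃ frac x y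
    toℚᵘ-/ x y = ℚP.toℚᵘ-fromℚᵘ (frac x y)

    -- The bounds of the theorem for s = (1 + a) / (1 + b), reduced to statements about ℕ.
    module Ratio (a b : ℕ) .(coprime : Coprime (suc a) (suc b)) where
      open +-*-Solver

      s : ℚ
      s = mkℚ +[1+ a ] b coprime

      ε : ℚ
      ε = (+ 2) / 1 ℚ.* 1/ s

      ε≃ : ℚ.toℚᵘ ε ≃ frac (2 ℕ.* suc b) a
      ε≃ = ℚᵘP.≃-trans (ℚP.toℚᵘ-homo-* ((+ 2) / 1) (1/ s))
             (ℚᵘP.≃-reflexive (trans (frac-* 2 0 (suc b) a) (cong (frac (2 ℕ.* suc b)) (ℕP.+-identityʳ a))))

      -- e_3 = 5/2, so e·D·s ≤ K yields (5/2)·D·s ≤ K.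
      hypothesis : ∀ D K → eApprox 3 ℚ.* ((+ D) / 1) ℚ.* s ℚ.≤ (+ K) / 1 →
        5 ℕ.* D ℕ.* suc a ℕ.≤ K ℕ.* (2 ℕ.* suc b)
      hypothesis D K h = subst₂ ℕ._≤_
          (solve 2 (λ D a → con 5 :* D :* (con 1 :+ a) :* con 1 := con 5 :* D :* (con 1 :+ a)) refl D a)
          (cong (K ℕ.*_) (solve 1 (λ b → con 1 :+ (b :+ (con 0 :+ con 1 :* con 1) :* (con 1 :+ b)) := con 2 :* (con 1 :+ b)) refl b))
          (frac-≤⁻¹ _ _ _ _ in-frac)
        where
        lhs≃ : ℚ.toℚᵘ (eApprox 3 ℚ.* ((+ D) / 1) ℚ.* s) ≃ frac 5 1 ℚᵘ.* frac D 0 ℚᵘ.* frac (suc a) b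
        lhs≃ = ℚᵘP.≃-trans (ℚP.toℚᵘ-homo-* (eApprox 3 ℚ.* ((+ D) / 1)) s)
          (ℚᵘP.*-congʳ (ℚᵘP.≃-trans (ℚP.toℚᵘ-homo-* (eApprox 3) ((+ D) / 1)) (ℚᵘP.*-congˡ {frac 5 1} (toℚᵘ-/ D 0))))
        in-frac : frac (5 ℕ.* D ℕ.* suc a) (b ℕ.+ (0 ℕ.+ 1 ℕ.* 1) ℕ.* suc b) ℚᵘ.≤ frac K 0
        in-frac = subst (ℚᵘ._≤ frac K 0) (trans (cong (ℚᵘ._* frac (suc a) b) (frac-* 5 1 D 0)) (frac-* (5 ℕ.* D) (0 ℕ.+ 1 ℕ.* 1) (suc a) b))
          (ℚᵘP.≤-respˡ-≃ lhs≃ (ℚᵘP.≤-respʳ-≃ (toℚᵘ-/ K 0) (ℚP.toℚᵘ-mono-≤ h)))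

      upper : ∀ T m → T ℕ.* (2 ℕ.* suc a) ℕ.≤ (suc a ℕ.+ 4 ℕ.* suc b) ℕ.* suc m →
        (+ T) / suc m ℚ.≤ (+ 1) / 2 ℚ.+ ε
      upper T m h = ℚP.toℚᵘ-cancel-≤ (ℚᵘP.≤-respˡ-≃ (ℚᵘP.≃-sym (toℚᵘ-/ T m)) (ℚᵘP.≤-respʳ-≃ (ℚᵘP.≃-sym rhs≃) in-frac))
        where
        rhs≃ : ℚ.toℚᵘ ((+ 1) / 2 ℚ.+ ε) ≃ frac 1 1 ℚᵘ.+ frac (2 ℕ.* suc b) a
        rhs≃ = ℚᵘP.≃-trans (ℚP.toℚᵘ-homo-+ ((+ 1) / 2) ε) (ℚᵘP.+-congʳ (frac 1 1) ε≃)
        in-frac : frac T m ℚᵘ.≤ frac 1 1 ℚᵘ.+ frac (2 ℕ.* suc b) a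
        in-frac rewrite frac-+ 1 1 (2 ℕ.* suc b) a = frac-≤ _ _ _ _ (subst₂ ℕ._≤_
          (cong (T ℕ.*_) (solve 1 (λ a → con 2 :* (con 1 :+ a) := con 1 :+ (a :+ con 1 :* (con 1 :+ a))) refl a))
          (cong (ℕ._* suc m) (solve 2 (λ a b → (con 1 :+ a) :+ con 4 :* (con 1 :+ b) := con 1 :* (con 1 :+ a) :+ con 2 :* (con 1 :+ b) :* con 2) refl a b))
          h)

      lower : ∀ T m → suc a ℕ.* suc m ℕ.≤ 2 ℕ.* T ℕ.* suc a ℕ.+ 4 ℕ.* suc b ℕ.* suc m →
        (+ 1) / 2 ℚ.- ε ℚ.≤ (+ T) / suc m
      lower T m h = ℚP.toℚᵘ-cancel-≤ (ℚᵘP.≤-respʳ-≃ (ℚᵘP.≃-sym (toℚᵘ-/ T m)) (ℚᵘP.≤-respˡ-≃ (ℚᵘP.≃-sym lhs≃) in-frac))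
        where
        E : ℚᵘ
        E = frac (2 ℕ.* suc b) a
        lhs≃ : ℚ.toℚᵘ ((+ 1) / 2 ℚ.- ε) ≃ frac 1 1 ℚᵘ.+ (ℚᵘ.- E)
        lhs≃ = ℚᵘP.≃-trans (ℚP.toℚᵘ-homo-+ ((+ 1) / 2) (ℚ.- ε))
          (ℚᵘP.+-congʳ (frac 1 1) (ℚᵘP.≃-trans (ℚP.toℚᵘ-homo‿- ε) (ℚᵘP.-‿cong ε≃)))
        half≤ : frac 1 1 ℚᵘ.≤ frac T m ℚᵘ.+ E
        half≤ rewrite frac-+ T m (2 ℕ.* suc b) a = frac-≤ _ _ _ _ (subst₂ ℕ._≤_
          (solve 2 (λ a m → (con 1 :+ a) :* (con 1 :+ m) := con 1 :* (con 1 :+ (a :+ m :* (con 1 :+ a)))) refl a m)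
          (solve 4 (λ T a b m → con 2 :* T :* (con 1 :+ a) :+ con 4 :* (con 1 :+ b) :* (con 1 :+ m) := (T :* (con 1 :+ a) :+ con 2 :* (con 1 :+ b) :* (con 1 :+ m)) :* con 2) refl T a b m)
          h)
        in-frac : frac 1 1 ℚᵘ.+ (ℚᵘ.- E) ℚᵘ.≤ frac T m
        in-frac = ℚᵘP.≤-trans (ℚᵘP.+-monoˡ-≤ (ℚᵘ.- E) half≤) (ℚᵘP.≤-reflexive
          (ℚᵘP.≃-trans (ℚᵘP.+-assoc (frac T m) E (ℚᵘ.- E)) (ℚᵘP.≃-trans (ℚᵘP.+-congʳ (frac T m) (ℚᵘP.+-inverseʳ E)) (ℚᵘP.+-identityʳ (frac T m)))))

    prTrue≡ : ∀ {n} (Φ : CNF n) (i : Fin n) m → # (sat Φ) ≡ suc m →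
      prTrue Φ i ≡ (+ # (λ σ → sat Φ σ ∧ lit i true σ)) / suc m
    prTrue≡ {n} Φ i m N≡1+m =
      trans (by-length (trans (length-select (sat Φ) (allAssignments n)) N≡1+m))
            (cong (λ x → (+ x) / suc m) (trans (length-select (λ σ → lookup σ i) (satAssignments Φ))
                                               (count-select (sat Φ) (λ σ → lookup σ i) (allAssignments n))))
      where
      by-length : length (satAssignments Φ) ≡ suc m →
        prTrue Φ i ≡ (+ length (select (λ σ → lookup σ i) (satAssignments Φ))) / suc m
      by-length len with length (satAssignments Φ)
      by-length refl | .(suc m) = refl

open import Defs
open import Data.Nat as ℕ using (ℕ; _*_; _^_)
open import Data.Fin using (Fin)
open import Data.Integer using (+_)
open import Data.Rational as ℚ using (ℚ; 0ℚ; _/_; 1/_; _-_; _+_; _>_; >-nonZero)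
open import Data.List.Relation.Unary.All using (All)
open import Data.Product using (_×_)
open import Data.Sum using (_⊎_)
open import Relation.Binary.PropositionalEquality using (_≡_)

open import Data.Bool using (true; false)
open import Data.Nat using (suc; pred; s≤s; z≤n)
import Data.Nat.Properties as ℕP
open import Data.Integer using (+[1+_]; +0; -[1+_]; +<+)
open import Data.Rational using (mkℚ; *<*)
open import Data.Product using (_,_)
open import Relation.Binary.PropositionalEquality using (subst; sym; trans)
open Proof
open Proof.Fractions

corollary2p3 :
  (C n k d : ℕ) → (C ≡ 2 ⊎ C ≡ 6) →
  (Φ : CNF n) →
  All (λ c → k ℕ.≤ numVars c × numVars c ℕ.≤ C * k) Φ →
  ((i : Fin n) → degree Φ i ℕ.≤ d) →
  (s : ℚ) → (s>0 : s > 0ℚ) →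
  ((N : ℕ) → eApprox N ℚ.* ((+ (C * d * k)) / 1) ℚ.* s ℚ.≤ (+ (2 ^ k)) / 1) →
  Satisfiable Φ →
  (i : Fin n) →
    ((+ 1) / 2 - ((+ 2) / 1) ℚ.* (1/_ s {{>-nonZero s>0}}) ℚ.≤ prTrue Φ i)
    × (prTrue Φ i ℚ.≤ (+ 1) / 2 + ((+ 2) / 1) ℚ.* (1/_ s {{>-nonZero s>0}}))
corollary2p3 C n k d C∈ Φ clause-sizes degrees (mkℚ +[1+ a ] b coprime) s>0 e-bound (σ , σ✓) i =
  subst (λ p → ((+ 1) / 2 ℚ.- ε ℚ.≤ p) × (p ℚ.≤ (+ 1) / 2 ℚ.+ ε)) (sym (prTrue≡ Φ i m N≡1+m))
    (lower T m lower-ℕ , upper T m upper-ℕ)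
  where
  open Bias C n k d C∈ Φ clause-sizes degrees i
  open Ratio a b coprime
  m : ℕ
  m = pred (# (sat Φ))
  N≡1+m : # (sat Φ) ≡ suc m
  N≡1+m = sym (ℕP.suc-pred (# (sat Φ)) {{ℕ.>-nonZero (#-pos (sat Φ) σ σ✓)}})
  s-bound : 5 * D * suc a ℕ.≤ K * (2 * suc b)
  s-bound = hypothesis D K (e-bound 3)
  T : ℕ
  T = share true
  upper-ℕ : T * (2 * suc a) ℕ.≤ (suc a ℕ.+ 4 * suc b) * suc m
  upper-ℕ = share-bound (suc a) (suc b) (s≤s z≤n) s-bound true (suc m) N≡1+m
  lower-ℕ : suc a * suc m ℕ.≤ 2 * T * suc a ℕ.+ 4 * suc b * suc m
  lower-ℕ = complement-share T (share false) (suc m) (suc a) (suc b) (trans (sym (shares true)) N≡1+m)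
              (share-bound (suc a) (suc b) (s≤s z≤n) s-bound false (suc m) N≡1+m)
corollary2p3 C n k d C∈ Φ _ _ (mkℚ +0 _ _)        (*<* (+<+ ())) _ _ _
corollary2p3 C n k d C∈ Φ _ _ (mkℚ -[1+ _ ] _ _) (*<* ())       _ _ _
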